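{- If $E=\{n_1<n_2<\cdots\}\subset\mathbb{N}$ satisfies $\lim_{i\to\infty}(n_{i+1}-n_i)=\infty$, then there is a partition $E=E_1\cup E_2$ such that $(E_1-E_1)\cup(E_2-E_2)$ is not syndetic. In particular, there exists a thick set which is not chromatically $E$-intersective.
   Context: $\mathbb{N}=\{1,2,3,\dots\}$, $A-A=\{a-b:a,b\in A\}$. $S\subset\mathbb{N}$ is thick if it contains arbitrarily long intervals of consecutive integers; syndetic if $S-F\supset\mathbb{N}$ for some finite $F$; a set $S\subset\mathbb{Z}$ is syndetic if $S\cap\mathbb{N}$ is. A set $R\subset\mathbb{N}$ is chromatically $E$-intersective if for every finite partition $E=\bigcup_{i=1}^kE_i$ there exists $i$ with $R\cap(E_i-E_i)\neq\varnothing$. -}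

module Defs where

open import Data.Nat using (ℕ; _+_; _∸_; _≤_; _<_)
open import Data.Integer using (ℤ; +_; _-_)
open import Data.Fin using (Fin)
open import Data.List using (List)
open import Data.List.Relation.Unary.All using (All)
open import Data.List.Relation.Unary.Any using (Any)
open import Data.Product using (Σ; ∃; _×_)
open import Relation.Binary.PropositionalEquality using (_≡_)

-- Subsets of ℕ = {1,2,...} are predicates on Agda's ℕ (containing 0);
-- positivity is imposed explicitly where needed.  Subsets of ℤ are predicates on ℤ.

DiffSet : (ℕ → Set) → ℤ → Set
DiffSet A z = ∃ λ a → ∃ λ b → A a × A b × (z ≡ (+ a) - (+ b))

Syndetic : (ℕ → Set) → Set
Syndetic S = Σ (List ℕ) λ F → All (1 ≤_) F ×
  (∀ m → 1 ≤ m → Any (λ f → S (m + f)) F)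

SyndeticZ : (ℤ → Set) → Set
SyndeticZ S = Syndetic (λ m → 1 ≤ m × S (+ m))

Thick : (ℕ → Set) → Set
Thick S = ∀ L → ∃ λ a → 1 ≤ a × (∀ k → k < L → S (a + k))

Cell : ∀ {k} → (ℕ → Set) → (ℕ → Fin k) → Fin k → ℕ → Set
Cell E c i x = E x × (c x ≡ i)

ChromIntersective : (ℕ → Set) → (ℕ → Set) → Set
ChromIntersective E R = ∀ k (c : ℕ → Fin k) →
  ∃ λ (i : Fin k) → ∃ λ r → R r × DiffSet (Cell E c i) (+ r)

RangeOf : (ℕ → ℕ) → ℕ → Set
RangeOf n x = ∃ λ i → n i ≡ x

-- Choose block starts P₀ < P₁ < ⋯ (blockStart) and windows [V_t, V_t + t) (windowStart).
-- Window t sits just above n_{K_t} (anchor), with K_t so far out that the gap after it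
-- exceeds n_{P_t} + t, and P_{t+1} lies past the point from which all gaps exceed V_t + t.
-- Then a difference n_j - n_i in window t forces P_t ≤ i < j < P_{t+1}, and since gaps past
-- P_t are at least t, j determines i.  So in the graph on E joining a < b when b - a lies in
-- a window, every vertex has at most one smaller neighbour, and colouring each vertex
-- opposite to that neighbour is proper.  Hence no colour class has a difference in the
-- thick union of the windows, which is therefore not chromatically E-intersective, and the
-- monochromatic differences miss arbitrarily long intervals, so they are not syndetic.
module Submission where

open import Defs
open import Data.Nat using (ℕ; suc; _∸_; _≤_; _<_)
open import Data.Bool using (Bool; true; false)
open import Data.Product using (∃; _×_)
open import Data.Sum using (_⊎_)
open import Relation.Nullary using (¬_)
open import Relation.Binary.PropositionalEquality using (_≡_)

open import Data.Nat using (zero; _+_; z≤n; s≤s; _<′_; ≤′-refl; ≤′-step; _≤?_; _<?_; _≟_)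
open import Data.Nat.Properties
open import Data.Nat.ListAction using (sum)
open import Data.Nat.Tactic.RingSolver using (solve-∀)
open import Data.Integer as ℤ using (ℤ; +_)
import Data.Integer.Properties as ℤ
import Data.Integer.Tactic.RingSolver as ℤ-Solver
open import Data.Bool using (not)
open import Data.Bool.Properties using (not-¬)
open import Data.Fin using (Fin)
open import Data.Fin.Properties using (2↔Bool)
open import Data.List using (List; _∷_)
open import Data.List.Relation.Unary.Any using (Any; here; there)
open import Data.Product using (_,_; proj₁; proj₂)
open import Data.Sum using (inj₁; inj₂)
open import Data.Empty using (⊥-elim)
open import Function using (_∘_; Injection)
open import Function.Properties.Inverse using (↔-sym; ↔⇒↣)
open import Relation.Nullary using (Dec; yes; no)
open import Relation.Nullary.Decidable using (_×-dec_; map′)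
open import Relation.Binary.Definitions using (tri<; tri≈; tri>)
open import Relation.Binary.PropositionalEquality using (refl; sym; trans; cong; subst; module ≡-Reasoning)

+r≡+a-+b⇒a≡b+r : ∀ a b r → + r ≡ + a ℤ.- + b → a ≡ b + r
+r≡+a-+b⇒a≡b+r a b r e = ℤ.+-injective (begin
    + a                    ≡⟨ sym (x+[y-x]≡y (+ b) (+ a)) ⟩
    + b ℤ.+ (+ a ℤ.- + b)  ≡⟨ cong (λ z → + b ℤ.+ z) (sym e) ⟩
    + b ℤ.+ + r            ≡⟨ sym (ℤ.pos-+ b r) ⟩
    + (b + r)              ∎)
  where
  open ≡-Reasoning
  x+[y-x]≡y : ∀ (x y : ℤ) → x ℤ.+ (y ℤ.- x) ≡ y
  x+[y-x]≡y = ℤ-Solver.solve-∀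

any-≤-sum : ∀ {P : ℕ → Set} (F : List ℕ) → Any P F → ∃ λ f → f ≤ sum F × P f
any-≤-sum (f ∷ F) (here p)  = f , m≤m+n f (sum F) , p
any-≤-sum (f ∷ F) (there p) with any-≤-sum F p
... | g , g≤ΣF , q = g , ≤-trans g≤ΣF (m≤n+m (sum F) f) , q

thick-complement⇒¬syndetic : ∀ {S : ℕ → Set} → Thick (λ m → ¬ S m) → ¬ Syndetic S
thick-complement⇒¬syndetic thick (F , _ , cover) with thick (suc (sum F))
... | a , 1≤a , avoids with any-≤-sum F (cover a 1≤a)
...   | f , f≤ΣF , S[a+f] = avoids f (s≤s f≤ΣF) S[a+f]

thick-⊆ : ∀ {P Q : ℕ → Set} → (∀ x → P x → Q x) → Thick P → Thick Q
thick-⊆ P⊆Q thick L = let (a , 1≤a , inside) = thick L in a , 1≤a , λ k k<L → P⊆Q (a + k) (inside k k<L)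

colouring-refutes-intersective : ∀ {E R : ℕ → Set} {k} (c : ℕ → Fin k) →
  (∀ {i r} → R r → ¬ DiffSet (Cell E c i) (+ r)) → ¬ ChromIntersective E R
colouring-refutes-intersective c avoid intersective =
  let (_ , _ , r∈R , d) = intersective _ c in avoid r∈R d

module StrictlyIncreasing (f : ℕ → ℕ) (f-step : ∀ i → f i < f (suc i)) where

  mono-< : ∀ {i j} → i < j → f i < f j
  mono-< = go ∘ ≤⇒≤′
    where
    go : ∀ {i j} → i <′ j → f i < f j
    go ≤′-refl    = f-step _
    go (≤′-step p) = <-trans (go p) (f-step _)

  mono-≤ : ∀ {i j} → i ≤ j → f i ≤ f j
  mono-≤ i≤j with m≤n⇒m<n∨m≡n i≤j
  ... | inj₁ i<j  = <⇒≤ (mono-< i<j)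
  ... | inj₂ refl = ≤-refl

  cancel-< : ∀ {i j} → f i < f j → i < j
  cancel-< fi<fj = ≰⇒> (λ j≤i → <⇒≱ fi<fj (mono-≤ j≤i))

  i≤f[i] : ∀ i → i ≤ f i
  i≤f[i] zero    = z≤n
  i≤f[i] (suc i) = ≤-trans (s≤s (i≤f[i] i)) (f-step i)

  range? : ∀ x → Dec (RangeOf f x)
  range? x = map′ (λ (i , _ , e) → i , e)
                  (λ (i , e) → i , s≤s (subst (i ≤_) e (i≤f[i] i)) , e)
                  (anyUpTo? (λ i → f i ≟ x) (suc x))

-- Colour j by the parity of the length of its chain of smaller neighbours; the chain is
-- followed with explicit fuel, which always suffices because it strictly decreases.
module ParityColouring (Edge : ℕ → ℕ → Set) (Edge? : ∀ i j → Dec (Edge i j))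
    (lower-unique : ∀ {i i' j} → i < j → i' < j → Edge i j → Edge i' j → i ≡ i') where

  private
    lowerNeighbour? : ∀ j → Dec (∃ λ i → i < j × Edge i j)
    lowerNeighbour? j = anyUpTo? (λ i → Edge? i j) j

    colourWithFuel : ℕ → ℕ → Bool
    colourWithFuel zero       j = true
    colourWithFuel (suc fuel) j with lowerNeighbour? j
    ... | yes (i , _) = not (colourWithFuel fuel i)
    ... | no _        = true

    fuel-irrelevant : ∀ f g j → j < f → j < g → colourWithFuel f j ≡ colourWithFuel g j
    fuel-irrelevant (suc f) (suc g) j (s≤s j≤f) (s≤s j≤g) with lowerNeighbour? j
    ... | yes (i , i<j , _) =
            cong not (fuel-irrelevant f g i (<-≤-trans i<j j≤f) (<-≤-trans i<j j≤g))
    ... | no _ = refl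

  colour : ℕ → Bool
  colour j = colourWithFuel (suc j) j

  colour-edge : ∀ {i j} → i < j → Edge i j → colour j ≡ not (colour i)
  colour-edge {i} {j} i<j edge with lowerNeighbour? j
  ... | no none = ⊥-elim (none (i , i<j , edge))
  ... | yes (i' , i'<j , edge') with lower-unique i'<j i<j edge' edge
  ...   | refl = cong not (fuel-irrelevant j (suc i') i' i'<j ≤-refl)

module WindowedDifferences (n : ℕ → ℕ) (n-step : ∀ i → n i < n (suc i))
    (gapFrom : ℕ → ℕ) (gap : ∀ M i → gapFrom M ≤ i → n i + M ≤ n (suc i)) where

  open StrictlyIncreasing n n-step

  mutual
    blockStart : ℕ → ℕ
    blockStart zero    = 0
    blockStart (suc t) = suc (gapFrom (windowStart t + t) + blockStart t)

    anchor : ℕ → ℕ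
    anchor t = gapFrom (suc (n (blockStart t) + t)) + blockStart t

    windowStart : ℕ → ℕ
    windowStart t = suc (n (anchor t))

  Window : ℕ → ℕ → Set
  Window t r = windowStart t ≤ r × r < windowStart t + t

  Windowed : ℕ → Set
  Windowed r = ∃ λ t → Window t r

  private
    module Block = StrictlyIncreasing blockStart (λ t → s≤s (m≤n+m (blockStart t) _))

  t<windowStart : ∀ t → t < windowStart t
  t<windowStart t = s≤s (begin
    t                                 ≤⟨ Block.i≤f[i] t ⟩
    blockStart t                      ≤⟨ m≤n+m (blockStart t) _ ⟩
    anchor t                          ≤⟨ i≤f[i] (anchor t) ⟩
    n (anchor t)                      ∎)
    where open ≤-Reasoning

  windowed-positive : ∀ r → Windowed r → 1 ≤ r
  windowed-positive r (_ , V≤r , _) = ≤-trans (s≤s z≤n) V≤r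

  windowed-thick : Thick Windowed
  windowed-thick L = windowStart L , s≤s z≤n ,
    λ k k<L → L , m≤m+n (windowStart L) k , +-monoʳ-< (windowStart L) k<L

  windowed? : ∀ r → Dec (Windowed r)
  windowed? r = map′ (λ (t , _ , w) → t , w)
                     (λ (t , w) → t , <-≤-trans (t<windowStart t) (proj₁ w) , w)
                     (anyUpTo? window? r)
    where
    window? : ∀ t → Dec (Window t r)
    window? t = (windowStart t ≤? r) ×-dec (r <? windowStart t + t)

  gap-past-block : ∀ t i → blockStart t ≤ i → n i + t ≤ n (suc i)
  gap-past-block zero    i _ = ≤-trans (≤-reflexive (+-identityʳ (n i))) (<⇒≤ (n-step i))
  gap-past-block (suc t) i P≤i =
    ≤-trans (+-monoʳ-≤ (n i) (+-monoˡ-≤ t (s≤s z≤n)))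
            (gap (windowStart t + t) i (m+n≤o⇒m≤o _ (<⇒≤ P≤i)))

  -- Otherwise n_j would lie strictly between n_{K_t} and n_{K_t + 1}.
  window-lower : ∀ {i j r t} → n j ≡ n i + r → Window t r → blockStart t ≤ i
  window-lower {i} {j} {r} {t} e (V≤r , r<V+t) = ≮⇒≥ λ i<P →
    <⇒≱ (cancel-< nK<nj) (≤-pred (cancel-< (nj<nK′ i<P)))
    where
    K = anchor t
    nP = n (blockStart t)
    nK<nj : n K < n j
    nK<nj = subst (n K <_) (sym e) (≤-trans V≤r (m≤n+m r (n i)))
    rearrange : ∀ p k t → p + (suc k + t) ≡ k + suc (p + t)
    rearrange = solve-∀
    nj<nK′ : i < blockStart t → n j < n (suc K)
    nj<nK′ i<P = begin-strict
      n j                       ≡⟨ e ⟩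
      n i + r                   <⟨ +-mono-< (mono-< i<P) r<V+t ⟩
      nP + (windowStart t + t)  ≡⟨ rearrange nP (n K) t ⟩
      n K + suc (nP + t)        ≤⟨ gap (suc (nP + t)) K (m≤m+n _ (blockStart t)) ⟩
      n (suc K)                 ∎
      where open ≤-Reasoning

  window-upper : ∀ {i j r t} → i < j → n j ≡ n i + r → Window t r → j < blockStart (suc t)
  window-upper {i} {suc j} {r} {t} (s≤s i≤j) e (_ , r<V+t) = s≤s (≰⇒> λ G+P≤j →
    <⇒≱ r<V+t (+-cancelˡ-≤ (n i) _ _ (begin
      n i + (windowStart t + t)  ≤⟨ +-monoˡ-≤ _ (mono-≤ i≤j) ⟩
      n j + (windowStart t + t)  ≤⟨ gap _ j (m+n≤o⇒m≤o _ G+P≤j) ⟩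
      n (suc j)                  ≡⟨ e ⟩
      n i + r                    ∎)))
    where open ≤-Reasoning

  window-index-≤ : ∀ {i i' j r r' t t'} → i < j → i' < j →
    n j ≡ n i + r → n j ≡ n i' + r' → Window t r → Window t' r' → t' ≤ t
  window-index-≤ i<j i'<j e e' w w' = ≤-pred (Block.cancel-<
    (≤-<-trans (window-lower e' w') (<-trans i'<j (window-upper i<j e w))))

  -- Gaps past the block start are at least t, so n_i' - n_i ≥ t pushes r out of the window.
  window-separated : ∀ {i i' j r r' t} → blockStart t ≤ i → i < i' →
    n j ≡ n i + r → n j ≡ n i' + r' → windowStart t ≤ r' → windowStart t + t ≤ r
  window-separated {i} {i'} {r = r} {r'} {t} P≤i i<i' e e' V≤r' = +-cancelˡ-≤ (n i) _ _ (begin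
    n i + (windowStart t + t)  ≡⟨ rearrange (n i) (windowStart t) t ⟩
    (n i + t) + windowStart t  ≤⟨ +-mono-≤ (≤-trans (gap-past-block t i P≤i) (mono-≤ i<i')) V≤r' ⟩
    n i' + r'                  ≡⟨ trans (sym e') e ⟩
    n i + r                    ∎)
    where
    open ≤-Reasoning
    rearrange : ∀ a v t → a + (v + t) ≡ (a + t) + v
    rearrange = solve-∀

  window-lower-unique : ∀ {i i' j r r' t t'} → i < j → i' < j →
    n j ≡ n i + r → n j ≡ n i' + r' → Window t r → Window t' r' → i ≡ i'
  window-lower-unique {i} {i'} i<j i'<j e e' w w'
    with ≤-antisym (window-index-≤ i'<j i<j e' e w' w) (window-index-≤ i<j i'<j e e' w w')
  ... | refl with <-cmp i i'
  ...   | tri< i<i' _ _ = ⊥-elim (<⇒≱ (proj₂ w) (window-separated (window-lower e w) i<i' e e' (proj₁ w')))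
  ...   | tri≈ _ i≡i' _ = i≡i'
  ...   | tri> _ _ i'<i = ⊥-elim (<⇒≱ (proj₂ w') (window-separated (window-lower e' w') i'<i e' e (proj₁ w)))

  WindowEdge : ℕ → ℕ → Set
  WindowEdge a b = RangeOf n a × RangeOf n b × Windowed (b ∸ a)

  windowEdge? : ∀ a b → Dec (WindowEdge a b)
  windowEdge? a b = range? a ×-dec range? b ×-dec windowed? (b ∸ a)

  windowEdge-lower-unique : ∀ {a a' b} → a < b → a' < b → WindowEdge a b → WindowEdge a' b → a ≡ a'
  windowEdge-lower-unique {b = b} a<b a'<b ((i , refl) , (j , refl) , _ , w) ((i' , refl) , _ , _ , w') =
    cong n (window-lower-unique (cancel-< a<b) (cancel-< a'<b) (split a<b) (split a'<b) w w')
    where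
    split : ∀ {a} → a < b → b ≡ a + (b ∸ a)
    split a<b = sym (m+[n∸m]≡n (<⇒≤ a<b))

  open ParityColouring WindowEdge windowEdge? windowEdge-lower-unique public using (colour; colour-edge)

  monochromatic-not-windowed : ∀ {a b r} → RangeOf n a → RangeOf n b → colour a ≡ colour b →
    + r ≡ + a ℤ.- + b → ¬ Windowed r
  monochromatic-not-windowed {a} {b} {r} a∈E b∈E same e w =
    not-¬ same (colour-edge b<a (b∈E , a∈E , subst Windowed (sym a∸b≡r) w))
    where
    a≡b+r : a ≡ b + r
    a≡b+r = +r≡+a-+b⇒a≡b+r a b r e
    b<a : b < a
    b<a = subst (b <_) (sym a≡b+r) (m<m+n b (windowed-positive r w))
    a∸b≡r : a ∸ b ≡ r
    a∸b≡r = trans (cong (_∸ b) a≡b+r) (m+n∸m≡n b r)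

  MonochromaticDifference : ℕ → Set
  MonochromaticDifference m = 1 ≤ m × (DiffSet (λ x → RangeOf n x × colour x ≡ true) (+ m)
                                      ⊎ DiffSet (λ x → RangeOf n x × colour x ≡ false) (+ m))

  windowed⇒not-monochromatic : ∀ m → Windowed m → ¬ MonochromaticDifference m
  windowed⇒not-monochromatic _ w (_ , inj₁ (_ , _ , (x∈E , cx) , (y∈E , cy) , e)) =
    monochromatic-not-windowed x∈E y∈E (trans cx (sym cy)) e w
  windowed⇒not-monochromatic _ w (_ , inj₂ (_ , _ , (x∈E , cx) , (y∈E , cy) , e)) =
    monochromatic-not-windowed x∈E y∈E (trans cx (sym cy)) e w

  monochromatic-differences-not-syndetic :
    ¬ SyndeticZ (λ z → DiffSet (λ x → RangeOf n x × colour x ≡ true) z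
                     ⊎ DiffSet (λ x → RangeOf n x × colour x ≡ false) z)
  monochromatic-differences-not-syndetic = thick-complement⇒¬syndetic {S = MonochromaticDifference}
    (thick-⊆ windowed⇒not-monochromatic windowed-thick)

  windowed-not-chromatically-intersective : ¬ ChromIntersective (RangeOf n) Windowed
  windowed-not-chromatically-intersective =
    colouring-refutes-intersective (to ∘ colour) λ w (_ , _ , (x∈E , cx) , (y∈E , cy) , e) →
      monochromatic-not-windowed x∈E y∈E (injective (trans cx (sym cy))) e w
    where open Injection (↔⇒↣ (↔-sym 2↔Bool)) using (to; injective)

theoremG : (n : ℕ → ℕ) → (∀ i → 1 ≤ n i) → (∀ i → n i < n (suc i)) →
    (∀ M → ∃ λ I → ∀ i → I ≤ i → M ≤ n (suc i) ∸ n i) →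
    (∃ λ (c : ℕ → Bool) →
        ¬ SyndeticZ (λ z → DiffSet (λ x → RangeOf n x × c x ≡ true) z
                         ⊎ DiffSet (λ x → RangeOf n x × c x ≡ false) z))
    × (∃ λ (R : ℕ → Set) → (∀ x → R x → 1 ≤ x) × Thick R
         × ¬ ChromIntersective (RangeOf n) R)
theoremG n _ n-step gaps-unbounded =
    (colour , monochromatic-differences-not-syndetic)
  , (Windowed , windowed-positive , windowed-thick , windowed-not-chromatically-intersective)
  where
  gap : ∀ M i → proj₁ (gaps-unbounded M) ≤ i → n i + M ≤ n (suc i)
  gap M i I≤i = subst (n i + M ≤_) (m+[n∸m]≡n (<⇒≤ (n-step i)))
                      (+-monoʳ-≤ (n i) (proj₂ (gaps-unbounded M) i I≤i))
  open WindowedDifferences n n-step (proj₁ ∘ gaps-unbounded) gap
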